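{- Let $\mathscr{A}$ be the language of shift plethystic trees. Then $$\mathscr{C}^{(1)}=\Big(\prod_{n=\infty}^{1}\frac{1}{1-X_n}\Big)\circ_s\mathscr{A}=\prod_{n=\infty}^{1}\frac{1}{1-\sigma^n\mathscr{A}},\qquad \sigma\mathscr{C}^{(1)}=\Big(\prod_{n=\infty}^{2}\frac{1}{1-X_n}\Big)\circ_s\mathscr{A}=\prod_{n=\infty}^{2}\frac{1}{1-\sigma^n\mathscr{A}}.$$
   Context: $\mathbb{X}=\{X_0,X_1,\dots\}$, $\mathbb{K}$ a field of characteristic zero, series in $\mathbb{K}\langle\langle\mathbb{X}\rangle\rangle$ (noncommutative), with convergence meaning each coefficient eventually stabilizes. $X_\kappa=X_{\kappa_1}\cdots X_{\kappa_m}$. $\mathscr{C}^{(1)}=\sum X_\kappa$ over compositions $\kappa$ (parts $\ge1$, empty included) with $\kappa_{i+1}-\kappa_i\le1$; $\sigma\mathscr{C}^{(1)}$ is the sum over those with all parts $\ge2$. $\sigma$ is the continuous algebra endomorphism with $\sigma X_i=X_{i+1}$. The symbol $\prod_{n=\infty}^{a}F_n$ means $\lim_{m\to\infty}F_mF_{m-1}\cdots F_a$; in particular $\prod_{n=\infty}^{1}\frac{1}{1-X_n}=\sum_\lambda X_\lambda$ over all partitions written in weakly decreasing order $\lambda_1\ge\lambda_2\ge\cdots\ge1$. Shift plethysm: for $R$ with zero constant term, $T\circ_sR=\sum_\kappa\langle T,X_\kappa\rangle(\sigma^{\kappa_1}R)\cdots(\sigma^{\kappa_l}R)$. A shift plethystic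 tree is a finite plane rooted tree each vertex colored by its height; its word lists the vertices in preorder writing $X_h$ for a vertex of height $h$; $\mathscr{A}$ is the sum of these words. -}

module Defs where

open import Data.Nat using (ℕ; zero; suc; _+_; _*_; _≤_; _≤ᵇ_)
open import Data.Bool using (Bool; true; false; _∧_; if_then_else_)
open import Data.List using (List; []; _∷_; _++_; map; foldr; concatMap; upTo; length)
open import Data.Nat.ListAction using (sum)
open import Data.Maybe using (Maybe; just; nothing; maybe)
import Data.Maybe as Maybe
open import Data.Product using (_×_; _,_; Σ; ∃-syntax)
open import Data.Fin using (Fin)
open import Function.Bundles using (_↔_)
open import Relation.Binary.PropositionalEquality using (_≡_)

-- Noncommutative series in the letters X₀, X₁, … with ℕ coefficients.
-- A word X_{i₁}⋯X_{iₘ} is the list [i₁,…,iₘ]; a series is its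
-- coefficient function.

Word : Set
Word = List ℕ

Series : Set
Series = Word → ℕ

splits : Word → List (Word × Word)
splits [] = ([] , []) ∷ []
splits (x ∷ w) = ([] , x ∷ w) ∷ map (λ { (u , v) → (x ∷ u , v) }) (splits w)

one : Series
one [] = 1
one (_ ∷ _) = 0

mul : Series → Series → Series
mul f g w = sum (map (λ { (u , v) → f u * g v }) (splits w))

pow : Series → ℕ → Series
pow S zero = one
pow S (suc k) = mul S (pow S k)

-- 1/(1-S) = Σ_k S^k.  For S with zero constant term, the coefficient of
-- w only receives contributions from k ≤ length w, so it is this finite sum.
geom : Series → Series
geom S w = sum (map (λ k → pow S k w) (upTo (suc (length w))))

-- σ : X_i ↦ X_{i+1}, continuous algebra endomorphism.
-- (σ f)(w) = f(w') if w = σ w', and 0 if w contains the letter X₀.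
unshift : Word → Maybe Word
unshift [] = just []
unshift (zero ∷ _) = nothing
unshift (suc x ∷ w) = Maybe.map (x ∷_) (unshift w)

shift : Series → Series
shift f w = maybe f 0 (unshift w)

shiftN : ℕ → Series → Series
shiftN zero f = f
shiftN (suc n) f = shift (shiftN n f)

_⟶_ : (ℕ → Series) → Series → Set
s ⟶ L = ∀ w → ∃[ N ] (∀ m → N ≤ m → s m w ≡ L w)

infix 4 _⟶_

-- ordProd F a k = F_{a+k} F_{a+k-1} ⋯ F_a ; so ∏_{n=∞}^{a} F_n is its limit as k → ∞
ordProd : (ℕ → Series) → ℕ → ℕ → Series
ordProd F a zero = F a
ordProd F a (suc k) = mul (F (a + suc k)) (ordProd F a k)

-- Shift plethysm  T ∘_s R = Σ_κ ⟨T,X_κ⟩ (σ^{κ₁}R)⋯(σ^{κ_l}R),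
-- an infinite sum, taken as the coefficientwise limit of the partial
-- sums over the finite sets of words κ of length ≤ M with letters ≤ M.

listsOfLen : ℕ → ℕ → List Word
listsOfLen b zero = [] ∷ []
listsOfLen b (suc l) = concatMap (λ x → map (x ∷_) (listsOfLen b l)) (upTo (suc b))

wordsUpTo : ℕ → List Word
wordsUpTo M = concatMap (listsOfLen M) (upTo (suc M))

prodList : List Series → Series
prodList = foldr mul one

plethPartial : Series → Series → ℕ → Series
plethPartial T R M w =
  sum (map (λ κ → T κ * prodList (map (λ k → shiftN k R) κ) w) (wordsUpTo M))

ind : Bool → ℕ
ind b = if b then 1 else 0

allGe : ℕ → Word → Bool
allGe a w = foldr (λ x b → (a ≤ᵇ x) ∧ b) true w

weaklyDecr : Word → Bool
weaklyDecr [] = true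
weaklyDecr (x ∷ []) = true
weaklyDecr (x ∷ y ∷ w) = (y ≤ᵇ x) ∧ weaklyDecr (y ∷ w)

stepOk : Word → Bool
stepOk [] = true
stepOk (x ∷ []) = true
stepOk (x ∷ y ∷ w) = (y ≤ᵇ suc x) ∧ stepOk (y ∷ w)

-- 𝒞^(1) = Σ X_κ over compositions (parts ≥ 1, empty included) with κ_{i+1}-κ_i ≤ 1
C1 : Series
C1 w = ind (allGe 1 w ∧ stepOk w)

-- ∏_{n=∞}^{a} 1/(1-X_n) = Σ_λ X_λ over partitions (weakly decreasing) with parts ≥ a
-- (the identity for a = 1 is given in the context; same for general a)
partSeries : ℕ → Series
partSeries a w = ind (allGe a w ∧ weaklyDecr w)

-- Shift plethystic trees: plane rooted trees, vertices coloured by height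
-- (root has height 0); the word lists vertices in preorder.

data Tree : Set where
  node : List Tree → Tree

mutual
  wordT : ℕ → Tree → Word
  wordT h (node ts) = h ∷ wordF (suc h) ts

  wordF : ℕ → List Tree → Word
  wordF h [] = []
  wordF h (t ∷ ts) = wordT h t ++ wordF h ts

-- A is the language 𝒜 = Σ_t word(t): the coefficient of w is the number
-- of shift plethystic trees whose word is w.
IsTreeLanguage : Series → Set
IsTreeLanguage A = ∀ w → Fin (A w) ↔ Σ Tree (λ t → wordT 0 t ≡ w)

-- 𝒜 has coefficient 1 exactly at the preorder words of plane trees, since such a word parses
-- uniquely; hence σʰ𝒜 is the language of trees rooted at height h, a tree being its root
-- followed by a forest one level up. Let Chain 1 a b be the words of 𝒞^(1) with parts ≥ a and
-- first part ≤ b, so that Forests h = Chain 1 h h. Then 1/(1 - σʰ𝒜) = Forests h, and splitting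
-- a word at its first root gives Forests (b + 1) · Chain 1 a b = Chain 1 a (b + 1), which
-- evaluates the ordered products. Splitting off the first tree instead gives
-- Chain 1 a b = 1 + Σ_{a ≤ x ≤ b} σˣ𝒜 · Chain 1 a x, the same recursion that the plethystic sum
-- over partitions with parts in [a, b] satisfies when grouped by the first part. All partial
-- products and sums are exact on a word once the truncation exceeds its length and first letter.

module Submission where

open import Defs
open import Algebra.Bundles using (CommutativeMonoid)
open import Axiom.UniquenessOfIdentityProofs using (module Decidable⇒UIP)
open import Data.Bool using (Bool; true; false; _∧_; T)
open import Data.Bool.Properties using (∧-assoc; ∧-identityʳ; T-≡; T-∧; ∧-commutativeMonoid)
open import Data.Empty using (⊥-elim)
open import Data.Fin as Fin using (Fin)
open import Data.Fin.Permutation using (↔⇒≡)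
open import Data.List using (List; []; _∷_; _++_; map; upTo; applyUpTo; concatMap; length; head)
open import Data.List.Properties using (map-++; map-∘; map-cong; ++-assoc; ++-identityʳ; ∷-injective; ≡-dec; length-++)
open import Data.Maybe using (just; nothing)
open import Data.Maybe.Relation.Unary.All using (All; just; nothing) renaming (map to All-map)
open import Data.Nat using (ℕ; zero; suc; _+_; _*_; _∸_; _≤_; _<_; _≤ᵇ_; _<ᵇ_; _≡ᵇ_; _≟_; _≤?_; z≤n; s≤s; z<s; s<s)
open import Data.Nat.Properties
open import Data.Nat.ListAction using (sum)
open import Data.Nat.ListAction.Properties using (sum-++)
open import Data.Nat.Tactic.RingSolver using (solve-∀)
open import Data.Product using (Σ; _×_; _,_; proj₁; proj₂)
open import Data.Unit using (tt)
open import Function using (_∘_; Equivalence)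
open import Function.Bundles using (_↔_; mk↔ₛ′)
open import Function.Properties.Inverse using (↔-trans)
open import Relation.Binary using (tri<; tri≈; tri>)
open import Relation.Binary.PropositionalEquality
open import Relation.Nullary using (¬_; yes; no)

open import Algebra.Properties.CommutativeSemigroup *-commutativeSemigroup
  using () renaming (x∙yz≈y∙xz to m*[n*o]≡n*[m*o])
open import Algebra.Properties.CommutativeSemigroup
  (CommutativeMonoid.commutativeSemigroup ∧-commutativeMonoid) using () renaming (interchange to ∧-interchange)

-- Products of series

∂ : ℕ → Series → Series
∂ x f w = f (x ∷ w)

mul-[] : ∀ f g → mul f g [] ≡ f [] * g []
mul-[] f g = +-identityʳ (f [] * g [])

mul-∷ : ∀ f g x w → mul f g (x ∷ w) ≡ f [] * g (x ∷ w) + mul (∂ x f) g w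
mul-∷ f g x w = cong (λ s → f [] * g (x ∷ w) + sum s)
  (trans (sym (map-∘ (splits w))) (map-cong (λ { (u , v) → refl }) (splits w)))

mul-cong-≤ : ∀ {f f' g g'} w →
  (∀ u → length u ≤ length w → f u ≡ f' u) → (∀ v → length v ≤ length w → g v ≡ g' v) →
  mul f g w ≡ mul f' g' w
mul-cong-≤ {f} {f'} {g} {g'} [] f≡ g≡ = begin
  mul f g []       ≡⟨ mul-[] f g ⟩
  f [] * g []      ≡⟨ cong₂ _*_ (f≡ [] z≤n) (g≡ [] z≤n) ⟩
  f' [] * g' []    ≡⟨ mul-[] f' g' ⟨
  mul f' g' []     ∎
  where open ≡-Reasoning
mul-cong-≤ {f} {f'} {g} {g'} (x ∷ w) f≡ g≡ = begin
  mul f g (x ∷ w)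
    ≡⟨ mul-∷ f g x w ⟩
  f [] * g (x ∷ w) + mul (∂ x f) g w
    ≡⟨ cong₂ _+_ (cong₂ _*_ (f≡ [] z≤n) (g≡ (x ∷ w) ≤-refl))
       (mul-cong-≤ w (λ u → f≡ (x ∷ u) ∘ s≤s) (λ v → g≡ v ∘ m≤n⇒m≤1+n)) ⟩
  f' [] * g' (x ∷ w) + mul (∂ x f') g' w
    ≡⟨ mul-∷ f' g' x w ⟨
  mul f' g' (x ∷ w)
    ∎
  where open ≡-Reasoning

mul-cong : ∀ {f f' g g'} → f ≗ f' → g ≗ g' → mul f g ≗ mul f' g'
mul-cong f≗ g≗ w = mul-cong-≤ w (λ u _ → f≗ u) (λ v _ → g≗ v)

mul-congʳ-< : ∀ {f g g'} w → f [] ≡ 0 → (∀ v → length v < length w → g v ≡ g' v) → mul f g w ≡ mul f g' w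
mul-congʳ-< {f} {g} {g'} [] f[]≡0 _ = begin
  mul f g []      ≡⟨ mul-[] f g ⟩
  f [] * g []     ≡⟨ cong (_* g []) f[]≡0 ⟩
  0               ≡⟨ cong (_* g' []) f[]≡0 ⟨
  f [] * g' []    ≡⟨ mul-[] f g' ⟨
  mul f g' []     ∎
  where open ≡-Reasoning
mul-congʳ-< {f} {g} {g'} (x ∷ w) f[]≡0 g≡ = begin
  mul f g (x ∷ w)
    ≡⟨ mul-∷ f g x w ⟩
  f [] * g (x ∷ w) + mul (∂ x f) g w
    ≡⟨ cong₂ _+_ (trans (cong (_* g (x ∷ w)) f[]≡0) (cong (_* g' (x ∷ w)) (sym f[]≡0)))
       (mul-cong-≤ {∂ x f} w (λ _ _ → refl) (λ v → g≡ v ∘ s≤s)) ⟩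
  f [] * g' (x ∷ w) + mul (∂ x f) g' w
    ≡⟨ mul-∷ f g' x w ⟨
  mul f g' (x ∷ w)
    ∎
  where open ≡-Reasoning

mul-zeroʳ : ∀ f w → mul f (λ _ → 0) w ≡ 0
mul-zeroʳ f [] = trans (mul-[] f (λ _ → 0)) (*-zeroʳ (f []))
mul-zeroʳ f (x ∷ w) = trans (mul-∷ f (λ _ → 0) x w) (cong₂ _+_ (*-zeroʳ (f [])) (mul-zeroʳ (∂ x f) w))

mul-*ˡ : ∀ c f g w → mul (λ u → c * f u) g w ≡ c * mul f g w
mul-*ˡ c f g [] = trans (mul-[] (λ u → c * f u) g) (trans (*-assoc c (f []) (g [])) (cong (c *_) (sym (mul-[] f g))))
mul-*ˡ c f g (x ∷ w) = begin
  mul (λ u → c * f u) g (x ∷ w)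
    ≡⟨ mul-∷ (λ u → c * f u) g x w ⟩
  c * f [] * g (x ∷ w) + mul (λ u → c * f (x ∷ u)) g w
    ≡⟨ cong₂ _+_ (*-assoc c (f []) _) (mul-*ˡ c (∂ x f) g w) ⟩
  c * (f [] * g (x ∷ w)) + c * mul (∂ x f) g w
    ≡⟨ *-distribˡ-+ c _ _ ⟨
  c * (f [] * g (x ∷ w) + mul (∂ x f) g w)
    ≡⟨ cong (c *_) (mul-∷ f g x w) ⟨
  c * mul f g (x ∷ w)
    ∎
  where open ≡-Reasoning

mul-*ʳ : ∀ c f g w → mul f (λ v → c * g v) w ≡ c * mul f g w
mul-*ʳ c f g [] =
  trans (mul-[] f (λ v → c * g v)) (trans (m*[n*o]≡n*[m*o] (f []) c (g [])) (cong (c *_) (sym (mul-[] f g))))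
mul-*ʳ c f g (x ∷ w) = begin
  mul f (λ v → c * g v) (x ∷ w)
    ≡⟨ mul-∷ f (λ v → c * g v) x w ⟩
  f [] * (c * g (x ∷ w)) + mul (∂ x f) (λ v → c * g v) w
    ≡⟨ cong₂ _+_ (m*[n*o]≡n*[m*o] (f []) c _) (mul-*ʳ c (∂ x f) g w) ⟩
  c * (f [] * g (x ∷ w)) + c * mul (∂ x f) g w
    ≡⟨ *-distribˡ-+ c _ _ ⟨
  c * (f [] * g (x ∷ w) + mul (∂ x f) g w)
    ≡⟨ cong (c *_) (mul-∷ f g x w) ⟨
  c * mul f g (x ∷ w)
    ∎
  where open ≡-Reasoning

mul-+ˡ : ∀ f f' g w → mul (λ u → f u + f' u) g w ≡ mul f g w + mul f' g w
mul-+ˡ f f' g [] =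
  trans (mul-[] (λ u → f u + f' u) g)
        (trans (*-distribʳ-+ (g []) (f []) (f' [])) (sym (cong₂ _+_ (mul-[] f g) (mul-[] f' g))))
mul-+ˡ f f' g (x ∷ w) = begin
  mul (λ u → f u + f' u) g (x ∷ w)
    ≡⟨ mul-∷ (λ u → f u + f' u) g x w ⟩
  (f [] + f' []) * g (x ∷ w) + mul (λ u → f (x ∷ u) + f' (x ∷ u)) g w
    ≡⟨ cong ((f [] + f' []) * g (x ∷ w) +_) (mul-+ˡ (∂ x f) (∂ x f') g w) ⟩
  (f [] + f' []) * g (x ∷ w) + (mul (∂ x f) g w + mul (∂ x f') g w)
    ≡⟨ regroup (f []) (f' []) (g (x ∷ w)) _ _ ⟩
  (f [] * g (x ∷ w) + mul (∂ x f) g w) + (f' [] * g (x ∷ w) + mul (∂ x f') g w)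
    ≡⟨ cong₂ _+_ (mul-∷ f g x w) (mul-∷ f' g x w) ⟨
  mul f g (x ∷ w) + mul f' g (x ∷ w)
    ∎
  where
  open ≡-Reasoning
  regroup : ∀ p p' q s t → (p + p') * q + (s + t) ≡ (p * q + s) + (p' * q + t)
  regroup = solve-∀

mul-+ʳ : ∀ f g h w → mul f (λ v → g v + h v) w ≡ mul f g w + mul f h w
mul-+ʳ f g h [] =
  trans (mul-[] f (λ v → g v + h v))
        (trans (*-distribˡ-+ (f []) (g []) (h [])) (sym (cong₂ _+_ (mul-[] f g) (mul-[] f h))))
mul-+ʳ f g h (x ∷ w) = begin
  mul f (λ v → g v + h v) (x ∷ w)
    ≡⟨ mul-∷ f (λ v → g v + h v) x w ⟩
  f [] * (g (x ∷ w) + h (x ∷ w)) + mul (∂ x f) (λ v → g v + h v) w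
    ≡⟨ cong (f [] * (g (x ∷ w) + h (x ∷ w)) +_) (mul-+ʳ (∂ x f) g h w) ⟩
  f [] * (g (x ∷ w) + h (x ∷ w)) + (mul (∂ x f) g w + mul (∂ x f) h w)
    ≡⟨ regroup (f []) (g (x ∷ w)) (h (x ∷ w)) _ _ ⟩
  (f [] * g (x ∷ w) + mul (∂ x f) g w) + (f [] * h (x ∷ w) + mul (∂ x f) h w)
    ≡⟨ cong₂ _+_ (mul-∷ f g x w) (mul-∷ f h x w) ⟨
  mul f g (x ∷ w) + mul f h (x ∷ w)
    ∎
  where
  open ≡-Reasoning
  regroup : ∀ p q r s t → p * (q + r) + (s + t) ≡ (p * q + s) + (p * r + t)
  regroup = solve-∀

mul-assoc : ∀ f g h w → mul (mul f g) h w ≡ mul f (mul g h) w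
mul-assoc f g h [] = begin
  mul (mul f g) h []      ≡⟨ mul-[] (mul f g) h ⟩
  mul f g [] * h []       ≡⟨ cong (_* h []) (mul-[] f g) ⟩
  f [] * g [] * h []      ≡⟨ *-assoc (f []) (g []) (h []) ⟩
  f [] * (g [] * h [])    ≡⟨ cong (f [] *_) (mul-[] g h) ⟨
  f [] * mul g h []       ≡⟨ mul-[] f (mul g h) ⟨
  mul f (mul g h) []      ∎
  where open ≡-Reasoning
mul-assoc f g h (x ∷ w) = begin
  mul (mul f g) h (x ∷ w)
    ≡⟨ mul-∷ (mul f g) h x w ⟩
  mul f g [] * h (x ∷ w) + mul (∂ x (mul f g)) h w
    ≡⟨ cong₂ _+_ (cong (_* h (x ∷ w)) (mul-[] f g)) ∂-of-product ⟩
  f [] * g [] * h (x ∷ w) + (f [] * mul (∂ x g) h w + mul (∂ x f) (mul g h) w)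
    ≡⟨ regroup (f []) (g []) (h (x ∷ w)) _ _ ⟩
  f [] * (g [] * h (x ∷ w) + mul (∂ x g) h w) + mul (∂ x f) (mul g h) w
    ≡⟨ cong (λ z → f [] * z + mul (∂ x f) (mul g h) w) (mul-∷ g h x w) ⟨
  f [] * mul g h (x ∷ w) + mul (∂ x f) (mul g h) w
    ≡⟨ mul-∷ f (mul g h) x w ⟨
  mul f (mul g h) (x ∷ w)
    ∎
  where
  open ≡-Reasoning
  regroup : ∀ a b c d e → a * b * c + (a * d + e) ≡ a * (b * c + d) + e
  regroup = solve-∀
  ∂-of-product : mul (∂ x (mul f g)) h w ≡ f [] * mul (∂ x g) h w + mul (∂ x f) (mul g h) w
  ∂-of-product = begin
    mul (∂ x (mul f g)) h w
      ≡⟨ mul-cong (λ v → mul-∷ f g x v) (λ _ → refl) w ⟩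
    mul (λ v → f [] * g (x ∷ v) + mul (∂ x f) g v) h w
      ≡⟨ mul-+ˡ (λ v → f [] * g (x ∷ v)) (mul (∂ x f) g) h w ⟩
    mul (λ v → f [] * g (x ∷ v)) h w + mul (mul (∂ x f) g) h w
      ≡⟨ cong₂ _+_ (mul-*ˡ (f []) (∂ x g) h w) (mul-assoc (∂ x f) g h w) ⟩
    f [] * mul (∂ x g) h w + mul (∂ x f) (mul g h) w
      ∎

-- Finite sums and the geometric series

∑< : ℕ → (ℕ → ℕ) → ℕ
∑< zero    f = 0
∑< (suc n) f = f 0 + ∑< n (f ∘ suc)

syntax ∑< n (λ i → e) = ∑[ i < n ] e

sum-applyUpTo : ∀ (f g : ℕ → ℕ) n → sum (map f (applyUpTo g n)) ≡ ∑[ i < n ] f (g i)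
sum-applyUpTo f g zero    = refl
sum-applyUpTo f g (suc n) = cong (f (g 0) +_) (sum-applyUpTo f (g ∘ suc) n)

sum-upTo : ∀ (f : ℕ → ℕ) n → sum (map f (upTo n)) ≡ ∑[ i < n ] f i
sum-upTo f = sum-applyUpTo f (λ i → i)

sum-concatMap : ∀ {X Y : Set} (f : Y → ℕ) (g : X → List Y) xs →
  sum (map f (concatMap g xs)) ≡ sum (map (λ x → sum (map f (g x))) xs)
sum-concatMap f g []       = refl
sum-concatMap f g (x ∷ xs) = begin
  sum (map f (g x ++ concatMap g xs))            ≡⟨ cong sum (map-++ f (g x) (concatMap g xs)) ⟩
  sum (map f (g x) ++ map f (concatMap g xs))    ≡⟨ sum-++ (map f (g x)) _ ⟩
  sum (map f (g x)) + sum (map f (concatMap g xs)) ≡⟨ cong (sum (map f (g x)) +_) (sum-concatMap f g xs) ⟩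
  sum (map f (g x)) + sum (map (λ x → sum (map f (g x))) xs) ∎
  where open ≡-Reasoning

∑-cong : ∀ {f g : ℕ → ℕ} n → (∀ i → i < n → f i ≡ g i) → ∑[ i < n ] f i ≡ ∑[ i < n ] g i
∑-cong zero    f≡g = refl
∑-cong (suc n) f≡g = cong₂ _+_ (f≡g 0 z<s) (∑-cong n (λ i → f≡g (suc i) ∘ s<s))

∑-zero : ∀ n → ∑[ i < n ] 0 ≡ 0
∑-zero zero    = refl
∑-zero (suc n) = ∑-zero n

∑-+ : ∀ f g n → ∑[ i < n ] (f i + g i) ≡ ∑[ i < n ] f i + ∑[ i < n ] g i
∑-+ f g zero    = refl
∑-+ f g (suc n) = trans (cong (f 0 + g 0 +_) (∑-+ (f ∘ suc) (g ∘ suc) n)) (+-+-interchange (f 0) (g 0) _ _)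
  where
  +-+-interchange : ∀ a b c d → a + b + (c + d) ≡ a + c + (b + d)
  +-+-interchange = solve-∀

∑-* : ∀ c f n → ∑[ i < n ] (c * f i) ≡ c * ∑[ i < n ] f i
∑-* c f zero    = sym (*-zeroʳ c)
∑-* c f (suc n) = trans (cong (c * f 0 +_) (∑-* c (f ∘ suc) n)) (sym (*-distribˡ-+ c (f 0) _))

∑-comm : ∀ (f : ℕ → ℕ → ℕ) m n → ∑[ i < m ] ∑[ j < n ] f i j ≡ ∑[ j < n ] ∑[ i < m ] f i j
∑-comm f zero    n = sym (∑-zero n)
∑-comm f (suc m) n = trans (cong (∑[ j < n ] f 0 j +_) (∑-comm (f ∘ suc) m n)) (sym (∑-+ (f 0) _ n))

∑-vanishing-tail : ∀ f n d → (∀ i → n ≤ i → f i ≡ 0) → ∑< (n + d) f ≡ ∑< n f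
∑-vanishing-tail f zero    d f≡0 = trans (∑-cong d (λ i _ → f≡0 i z≤n)) (∑-zero d)
∑-vanishing-tail f (suc n) d f≡0 = cong (f 0 +_) (∑-vanishing-tail (f ∘ suc) n d (λ i → f≡0 (suc i) ∘ s≤s))

∑-ind-≡ᵇ : ∀ y (g : ℕ → ℕ) n → ∑[ x < n ] (ind (y ≡ᵇ x) * g x) ≡ ind (y <ᵇ n) * g y
∑-ind-≡ᵇ y       g zero    = refl
∑-ind-≡ᵇ zero    g (suc n) = trans (cong (g 0 + 0 +_) (trans (∑-cong n (λ _ _ → refl)) (∑-zero n))) (+-identityʳ _)
∑-ind-≡ᵇ (suc y) g (suc n) = ∑-ind-≡ᵇ y (g ∘ suc) n

mul-∑ʳ : ∀ f (g : ℕ → Series) n w → mul f (λ v → ∑[ k < n ] g k v) w ≡ ∑[ k < n ] mul f (g k) w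
mul-∑ʳ f g zero    w = mul-zeroʳ f w
mul-∑ʳ f g (suc n) w =
  trans (mul-+ʳ f (g 0) (λ v → ∑[ k < n ] g (suc k) v) w) (cong (mul f (g 0) w +_) (mul-∑ʳ f (g ∘ suc) n w))

mul-sumʳ : ∀ {X : Set} f (g : X → Series) xs w →
  mul f (λ v → sum (map (λ x → g x v) xs)) w ≡ sum (map (λ x → mul f (g x) w) xs)
mul-sumʳ f g []       w = mul-zeroʳ f w
mul-sumʳ f g (x ∷ xs) w =
  trans (mul-+ʳ f (g x) (λ v → sum (map (λ x → g x v) xs)) w) (cong (mul f (g x) w +_) (mul-sumʳ f g xs w))

pow-cong : ∀ {S S'} → S ≗ S' → ∀ k → pow S k ≗ pow S' k
pow-cong S≗S' zero    = λ _ → refl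
pow-cong S≗S' (suc k) = mul-cong S≗S' (pow-cong S≗S' k)

geom-cong : ∀ {S S'} → S ≗ S' → geom S ≗ geom S'
geom-cong S≗S' w = cong sum (map-cong (λ k → pow-cong S≗S' k w) (upTo (suc (length w))))

pow-vanishes-on-short-words : ∀ S → S [] ≡ 0 → ∀ k v → length v < k → pow S k v ≡ 0
pow-vanishes-on-short-words S S[]≡0 (suc k) v (s≤s |v|≤k) = begin
  mul S (pow S k) v        ≡⟨ mul-congʳ-< {S} v S[]≡0 (λ u |u|<|v| →
                                pow-vanishes-on-short-words S S[]≡0 k u (<-≤-trans |u|<|v| |v|≤k)) ⟩
  mul S (λ _ → 0) v        ≡⟨ mul-zeroʳ S v ⟩
  0                        ∎
  where open ≡-Reasoning

geom-truncate : ∀ S → S [] ≡ 0 → ∀ N v → length v ≤ N → geom S v ≡ ∑[ k < suc N ] pow S k v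
geom-truncate S S[]≡0 N v |v|≤N = begin
  geom S v
    ≡⟨ sum-upTo (λ k → pow S k v) (suc (length v)) ⟩
  ∑[ k < suc (length v) ] pow S k v
    ≡⟨ ∑-vanishing-tail (λ k → pow S k v) (suc (length v)) (N ∸ length v)
       (λ k → pow-vanishes-on-short-words S S[]≡0 k v) ⟨
  ∑< (suc (length v) + (N ∸ length v)) (λ k → pow S k v)
    ≡⟨ cong (λ n → ∑< (suc n) (λ k → pow S k v)) (m+[n∸m]≡n |v|≤N) ⟩
  ∑[ k < suc N ] pow S k v
    ∎
  where open ≡-Reasoning

-- 1/(1 - S) = 1 + S · 1/(1 - S), read off at a nonempty word.
geom-∷ : ∀ S → S [] ≡ 0 → ∀ x w → geom S (x ∷ w) ≡ mul (∂ x S) (geom S) w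
geom-∷ S S[]≡0 x w = begin
  geom S (x ∷ w)
    ≡⟨ sum-upTo (λ k → pow S k (x ∷ w)) (suc (suc (length w))) ⟩
  ∑[ k < suc (length w) ] mul S (pow S k) (x ∷ w)
    ≡⟨ ∑-cong (suc (length w)) (λ k _ → trans (mul-∷ S (pow S k) x w)
       (cong (λ c → c * pow S k (x ∷ w) + mul (∂ x S) (pow S k) w) S[]≡0)) ⟩
  ∑[ k < suc (length w) ] mul (∂ x S) (pow S k) w
    ≡⟨ mul-∑ʳ (∂ x S) (pow S) (suc (length w)) w ⟨
  mul (∂ x S) (λ v → ∑[ k < suc (length w) ] pow S k v) w
    ≡⟨ mul-cong-≤ {∂ x S} w (λ _ _ → refl)
       (λ v |v|≤|w| → sym (geom-truncate S S[]≡0 (length w) v |v|≤|w|)) ⟩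
  mul (∂ x S) (geom S) w
    ∎
  where open ≡-Reasoning

-- Chains, forests and trees

T-ext : ∀ {p q} → (T p → T q) → (T q → T p) → p ≡ q
T-ext {true}  {true}  _ _ = refl
T-ext {true}  {false} p⇒q _ = ⊥-elim (p⇒q tt)
T-ext {false} {true}  _ q⇒p = ⊥-elim (q⇒p tt)
T-ext {false} {false} _ _ = refl

suc≤ᵇsuc : ∀ m n → (suc m ≤ᵇ suc n) ≡ (m ≤ᵇ n)
suc≤ᵇsuc zero    n = refl
suc≤ᵇsuc (suc m) n = refl

ind-∧ : ∀ p q → ind (p ∧ q) ≡ ind p * ind q
ind-∧ true  q = sym (*-identityˡ (ind q))
ind-∧ false q = refl

ind-T : ∀ {b} → T b → ind b ≡ 1
ind-T {true} _ = refl

ind-¬T : ∀ {b} → ¬ T b → ind b ≡ 0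
ind-¬T {true}  ¬t = ⊥-elim (¬t tt)
ind-¬T {false} _  = refl

-- Chain 1 a b: the words of 𝒞^(1) with all parts ≥ a and first part ≤ b;
-- Chain 0 a b: the partitions (weakly decreasing words) with parts in [a, b].
chainᵇ : ℕ → ℕ → ℕ → Word → Bool
chainᵇ d a b []      = true
chainᵇ d a b (y ∷ w) = ((a ≤ᵇ y) ∧ (y ≤ᵇ b)) ∧ chainᵇ d a (d + y) w

Chain : ℕ → ℕ → ℕ → Series
Chain d a b w = ind (chainᵇ d a b w)

-- The words of plane forests whose roots have height h.
Forests : ℕ → Series
Forests h = Chain 1 h h

treeᵇ : ℕ → Word → Bool
treeᵇ h []      = false
treeᵇ h (y ∷ w) = (y ≡ᵇ h) ∧ chainᵇ 1 (suc h) (suc h) w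

Trees : ℕ → Series
Trees h w = ind (treeᵇ h w)

C≥ : ℕ → Series
C≥ a w = ind (allGe a w ∧ stepOk w)

Chain-∷ : ∀ d a b y w → Chain d a b (y ∷ w) ≡ ind ((a ≤ᵇ y) ∧ (y ≤ᵇ b)) * Chain d a (d + y) w
Chain-∷ d a b y w = ind-∧ ((a ≤ᵇ y) ∧ (y ≤ᵇ b)) (chainᵇ d a (d + y) w)

Chain-∷-in : ∀ {d a b y} w → a ≤ y → y ≤ b → Chain d a b (y ∷ w) ≡ Chain d a (d + y) w
Chain-∷-in {d} {a} {b} {y} w a≤y y≤b = trans (Chain-∷ d a b y w)
  (trans (cong (_* Chain d a (d + y) w) (ind-T (Equivalence.from T-∧ (≤⇒≤ᵇ a≤y , ≤⇒≤ᵇ y≤b)))) (*-identityˡ _))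

Chain-∷-out : ∀ {d a b y} w → ¬ (a ≤ y × y ≤ b) → Chain d a b (y ∷ w) ≡ 0
Chain-∷-out {d} {a} {b} {y} w y∉[a,b] = trans (Chain-∷ d a b y w)
  (cong (_* Chain d a (d + y) w) (ind-¬T (λ t → y∉[a,b] (≤ᵇ⇒≤ a y (proj₁ (Equivalence.to T-∧ t)) ,
                                                         ≤ᵇ⇒≤ y b (proj₂ (Equivalence.to T-∧ t))))))

Trees-∷ : ∀ h y w → Trees h (y ∷ w) ≡ ind (y ≡ᵇ h) * Forests (suc h) w
Trees-∷ h y w = ind-∧ (y ≡ᵇ h) (chainᵇ 1 (suc h) (suc h) w)

Forests-∷ : ∀ h y w → Forests h (y ∷ w) ≡ ind (y ≡ᵇ h) * Chain 1 h (suc h) w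
Forests-∷ h y w with y ≟ h
... | yes refl = trans (Chain-∷-in w ≤-refl ≤-refl)
                       (sym (trans (cong (_* Chain 1 h (suc h) w) (ind-T (≡⇒≡ᵇ h h refl))) (*-identityˡ _)))
... | no y≢h   = trans (Chain-∷-out w (λ (h≤y , y≤h) → y≢h (≤-antisym y≤h h≤y)))
                       (sym (cong (_* Chain 1 h (suc h) w) (ind-¬T (y≢h ∘ ≡ᵇ⇒≡ y h))))

Chain-∷-raise-bound : ∀ {d a y z} w → a ≤ suc y →
  Chain d a y (z ∷ w) + ind (z ≡ᵇ suc y) * Chain d a (d + suc y) w ≡ Chain d a (suc y) (z ∷ w)
Chain-∷-raise-bound {d} {a} {y} {z} w a≤1+y with z ≟ suc y
... | yes refl = begin
  Chain d a y (suc y ∷ w) + ind (suc y ≡ᵇ suc y) * Chain d a (d + suc y) w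
    ≡⟨ cong₂ _+_ (Chain-∷-out w (λ (_ , 1+y≤y) → 1+n≰n 1+y≤y))
                 (trans (cong (_* Chain d a (d + suc y) w) (ind-T (≡⇒≡ᵇ y y refl))) (*-identityˡ _)) ⟩
  Chain d a (d + suc y) w
    ≡⟨ Chain-∷-in w a≤1+y ≤-refl ⟨
  Chain d a (suc y) (suc y ∷ w)
    ∎
  where open ≡-Reasoning
... | no z≢1+y = begin
  Chain d a y (z ∷ w) + ind (z ≡ᵇ suc y) * Chain d a (d + suc y) w
    ≡⟨ cong (λ i → Chain d a y (z ∷ w) + i * Chain d a (d + suc y) w) (ind-¬T (z≢1+y ∘ ≡ᵇ⇒≡ z (suc y))) ⟩
  Chain d a y (z ∷ w) + 0
    ≡⟨ +-identityʳ _ ⟩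
  Chain d a y (z ∷ w)
    ≡⟨ cong (λ b → ind (((a ≤ᵇ z) ∧ b) ∧ chainᵇ d a (d + z) w)) (T-ext
         (≤⇒≤ᵇ ∘ m≤n⇒m≤1+n ∘ ≤ᵇ⇒≤ z y)
         (λ t → ≤⇒≤ᵇ (≤-pred (≤∧≢⇒< (≤ᵇ⇒≤ z (suc y) t) z≢1+y)))) ⟩
  Chain d a (suc y) (z ∷ w)
    ∎
  where open ≡-Reasoning

-- Split by the first letter: either it is at most y, or it is a root y + 1 whose subtrees
-- form a forest at height y + 2.
Forests-mul-Chain : ∀ {a y} w → a ≤ suc y → mul (Forests (suc y)) (Chain 1 a y) w ≡ Chain 1 a (suc y) w
Forests-mul-Chain w = go (length w) w ≤-refl
  where
  go : ∀ n {a y} w → length w ≤ n → a ≤ suc y → mul (Forests (suc y)) (Chain 1 a y) w ≡ Chain 1 a (suc y) w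
  go n       []      _ _ = refl
  go (suc n) {a} {y} (z ∷ w) (s≤s |w|≤n) a≤1+y = begin
    mul (Forests (suc y)) (Chain 1 a y) (z ∷ w)
      ≡⟨ mul-∷ (Forests (suc y)) (Chain 1 a y) z w ⟩
    1 * Chain 1 a y (z ∷ w) + mul (∂ z (Forests (suc y))) (Chain 1 a y) w
      ≡⟨ cong₂ _+_ (*-identityˡ _) first-tree ⟩
    Chain 1 a y (z ∷ w) + ind (z ≡ᵇ suc y) * Chain 1 a (2 + y) w
      ≡⟨ Chain-∷-raise-bound w a≤1+y ⟩
    Chain 1 a (suc y) (z ∷ w)
      ∎
    where
    open ≡-Reasoning
    IH : ∀ {a' y'} v → length v ≤ length w → a' ≤ suc y' →
         mul (Forests (suc y')) (Chain 1 a' y') v ≡ Chain 1 a' (suc y') v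
    IH v |v|≤|w| = go n v (≤-trans |v|≤|w| |w|≤n)

    two-forests : mul (Chain 1 (suc y) (2 + y)) (Chain 1 a y) w ≡ Chain 1 a (2 + y) w
    two-forests = begin
      mul (Chain 1 (suc y) (2 + y)) (Chain 1 a y) w
        ≡⟨ mul-cong-≤ w (λ u |u|≤|w| → sym (IH u |u|≤|w| (n≤1+n (suc y)))) (λ _ _ → refl) ⟩
      mul (mul (Forests (2 + y)) (Forests (suc y))) (Chain 1 a y) w
        ≡⟨ mul-assoc (Forests (2 + y)) (Forests (suc y)) (Chain 1 a y) w ⟩
      mul (Forests (2 + y)) (mul (Forests (suc y)) (Chain 1 a y)) w
        ≡⟨ mul-cong-≤ {Forests (2 + y)} w (λ _ _ → refl) (λ v |v|≤|w| → IH v |v|≤|w| a≤1+y) ⟩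
      mul (Forests (2 + y)) (Chain 1 a (suc y)) w
        ≡⟨ IH w ≤-refl (m≤n⇒m≤1+n a≤1+y) ⟩
      Chain 1 a (2 + y) w
        ∎

    first-tree : mul (∂ z (Forests (suc y))) (Chain 1 a y) w ≡ ind (z ≡ᵇ suc y) * Chain 1 a (2 + y) w
    first-tree = begin
      mul (∂ z (Forests (suc y))) (Chain 1 a y) w
        ≡⟨ mul-cong (Forests-∷ (suc y) z) (λ _ → refl) w ⟩
      mul (λ v → ind (z ≡ᵇ suc y) * Chain 1 (suc y) (2 + y) v) (Chain 1 a y) w
        ≡⟨ mul-*ˡ (ind (z ≡ᵇ suc y)) (Chain 1 (suc y) (2 + y)) (Chain 1 a y) w ⟩
      ind (z ≡ᵇ suc y) * mul (Chain 1 (suc y) (2 + y)) (Chain 1 a y) w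
        ≡⟨ cong (ind (z ≡ᵇ suc y) *_) two-forests ⟩
      ind (z ≡ᵇ suc y) * Chain 1 a (2 + y) w
        ∎

ordProd-Forests : ∀ a k → ordProd Forests a k ≗ Chain 1 a (a + k)
ordProd-Forests a zero    w = cong (λ b → Chain 1 a b w) (sym (+-identityʳ a))
ordProd-Forests a (suc k) w rewrite +-suc a k =
  trans (mul-cong {Forests (suc (a + k))} (λ _ → refl) (ordProd-Forests a k) w)
        (Forests-mul-Chain w (m≤n⇒m≤1+n (m≤m+n a k)))

geom-Trees : ∀ h → geom (Trees h) ≗ Forests h
geom-Trees h w = go (length w) h w ≤-refl
  where
  go : ∀ n h w → length w ≤ n → geom (Trees h) w ≡ Forests h w
  go n       h []      _ = refl
  go (suc n) h (y ∷ w) (s≤s |w|≤n) = begin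
    geom (Trees h) (y ∷ w)
      ≡⟨ geom-∷ (Trees h) refl y w ⟩
    mul (∂ y (Trees h)) (geom (Trees h)) w
      ≡⟨ mul-cong (Trees-∷ h y) (λ _ → refl) w ⟩
    mul (λ v → ind (y ≡ᵇ h) * Forests (suc h) v) (geom (Trees h)) w
      ≡⟨ mul-*ˡ (ind (y ≡ᵇ h)) (Forests (suc h)) (geom (Trees h)) w ⟩
    ind (y ≡ᵇ h) * mul (Forests (suc h)) (geom (Trees h)) w
      ≡⟨ cong (ind (y ≡ᵇ h) *_) (mul-cong-≤ {Forests (suc h)} w (λ _ _ → refl)
         (λ v |v|≤|w| → go n h v (≤-trans |v|≤|w| |w|≤n))) ⟩
    ind (y ≡ᵇ h) * mul (Forests (suc h)) (Forests h) w
      ≡⟨ cong (ind (y ≡ᵇ h) *_) (Forests-mul-Chain w (n≤1+n h)) ⟩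
    ind (y ≡ᵇ h) * Chain 1 h (suc h) w
      ≡⟨ Forests-∷ h y w ⟨
    Forests h (y ∷ w)
      ∎
    where open ≡-Reasoning

Trees-mul-Chain : ∀ {a x} y w → a ≤ suc x → mul (Trees x) (Chain 1 a x) (y ∷ w) ≡ ind (y ≡ᵇ x) * Chain 1 a (suc x) w
Trees-mul-Chain {a} {x} y w a≤1+x = begin
  mul (Trees x) (Chain 1 a x) (y ∷ w)
    ≡⟨ mul-∷ (Trees x) (Chain 1 a x) y w ⟩
  mul (∂ y (Trees x)) (Chain 1 a x) w
    ≡⟨ mul-cong (Trees-∷ x y) (λ _ → refl) w ⟩
  mul (λ v → ind (y ≡ᵇ x) * Forests (suc x) v) (Chain 1 a x) w
    ≡⟨ mul-*ˡ (ind (y ≡ᵇ x)) (Forests (suc x)) (Chain 1 a x) w ⟩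
  ind (y ≡ᵇ x) * mul (Forests (suc x)) (Chain 1 a x) w
    ≡⟨ cong (ind (y ≡ᵇ x) *_) (Forests-mul-Chain w a≤1+x) ⟩
  ind (y ≡ᵇ x) * Chain 1 a (suc x) w
    ∎
  where open ≡-Reasoning

-- P is the step condition of slack d: stepOk for d = 1, weaklyDecr for d = 0.
module StepCondition (d : ℕ) (P : Word → Bool) (P-[] : P [] ≡ true) (P-[y] : ∀ y → P (y ∷ []) ≡ true)
                     (P-∷ : ∀ y z w → P (y ∷ z ∷ w) ≡ (z ≤ᵇ d + y) ∧ P (z ∷ w)) where

  chainᵇ-after : ∀ a y w → chainᵇ d a (d + y) w ≡ allGe a w ∧ P (y ∷ w)
  chainᵇ-after a y []      = sym (P-[y] y)
  chainᵇ-after a y (z ∷ w) = begin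
    ((a ≤ᵇ z) ∧ (z ≤ᵇ d + y)) ∧ chainᵇ d a (d + z) w
      ≡⟨ cong (((a ≤ᵇ z) ∧ (z ≤ᵇ d + y)) ∧_) (chainᵇ-after a z w) ⟩
    ((a ≤ᵇ z) ∧ (z ≤ᵇ d + y)) ∧ (allGe a w ∧ P (z ∷ w))
      ≡⟨ ∧-interchange (a ≤ᵇ z) (z ≤ᵇ d + y) (allGe a w) (P (z ∷ w)) ⟩
    ((a ≤ᵇ z) ∧ allGe a w) ∧ ((z ≤ᵇ d + y) ∧ P (z ∷ w))
      ≡⟨ cong (allGe a (z ∷ w) ∧_) (P-∷ y z w) ⟨
    allGe a (z ∷ w) ∧ P (y ∷ z ∷ w)
      ∎
    where open ≡-Reasoning

  Chain-head-bounded : ∀ a b w → All (_≤ b) (head w) → Chain d a b w ≡ ind (allGe a w ∧ P w)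
  Chain-head-bounded a b []      nothing    = cong ind (sym P-[])
  Chain-head-bounded a b (y ∷ w) (just y≤b) = cong ind (begin
    ((a ≤ᵇ y) ∧ (y ≤ᵇ b)) ∧ chainᵇ d a (d + y) w
      ≡⟨ cong₂ (λ t c → ((a ≤ᵇ y) ∧ t) ∧ c)
         (Equivalence.to T-≡ (≤⇒≤ᵇ y≤b)) (chainᵇ-after a y w) ⟩
    ((a ≤ᵇ y) ∧ true) ∧ (allGe a w ∧ P (y ∷ w))
      ≡⟨ cong (_∧ (allGe a w ∧ P (y ∷ w))) (∧-identityʳ (a ≤ᵇ y)) ⟩
    (a ≤ᵇ y) ∧ (allGe a w ∧ P (y ∷ w))
      ≡⟨ ∧-assoc (a ≤ᵇ y) (allGe a w) (P (y ∷ w)) ⟨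
    allGe a (y ∷ w) ∧ P (y ∷ w)
      ∎)
    where open ≡-Reasoning

Chain-as-C≥ : ∀ a b w → All (_≤ b) (head w) → Chain 1 a b w ≡ C≥ a w
Chain-as-C≥ = StepCondition.Chain-head-bounded 1 stepOk refl (λ _ → refl) (λ _ _ _ → refl)

Chain-as-partSeries : ∀ a b κ → All (_≤ b) (head κ) → Chain 0 a b κ ≡ partSeries a κ
Chain-as-partSeries = StepCondition.Chain-head-bounded 0 weaklyDecr refl (λ _ → refl) (λ _ _ _ → refl)

-- The shift σ

shift-cong : ∀ {f g} → f ≗ g → shift f ≗ shift g
shift-cong f≗g w with unshift w
... | just v  = f≗g v
... | nothing = refl

shiftN-cong : ∀ {f g} n → f ≗ g → shiftN n f ≗ shiftN n g
shiftN-cong zero    f≗g = f≗g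
shiftN-cong (suc n) f≗g = shift-cong (shiftN-cong n f≗g)

shift-suc-∷ : ∀ f x w → shift f (suc x ∷ w) ≡ shift (∂ x f) w
shift-suc-∷ f x w with unshift w
... | just v  = refl
... | nothing = refl

shift-* : ∀ c f w → shift (λ v → c * f v) w ≡ c * shift f w
shift-* c f w with unshift w
... | just v  = refl
... | nothing = sym (*-zeroʳ c)

shift-Chain : ∀ d a b → shift (Chain d a b) ≗ Chain d (suc a) (suc b)
shift-Chain d a b []          = refl
shift-Chain d a b (zero ∷ w)  = refl
shift-Chain d a b (suc y ∷ w) = begin
  shift (Chain d a b) (suc y ∷ w)
    ≡⟨ shift-suc-∷ (Chain d a b) y w ⟩
  shift (∂ y (Chain d a b)) w
    ≡⟨ shift-cong (Chain-∷ d a b y) w ⟩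
  shift (λ v → ind y∈[a,b] * Chain d a (d + y) v) w
    ≡⟨ shift-* (ind y∈[a,b]) (Chain d a (d + y)) w ⟩
  ind y∈[a,b] * shift (Chain d a (d + y)) w
    ≡⟨ cong (ind y∈[a,b] *_) (shift-Chain d a (d + y) w) ⟩
  ind y∈[a,b] * Chain d (suc a) (suc (d + y)) w
    ≡⟨ cong₂ (λ p e → ind p * Chain d (suc a) e w)
       (sym (cong₂ _∧_ (suc≤ᵇsuc a y) (suc≤ᵇsuc y b))) (sym (+-suc d y)) ⟩
  ind ((suc a ≤ᵇ suc y) ∧ (suc y ≤ᵇ suc b)) * Chain d (suc a) (d + suc y) w
    ≡⟨ Chain-∷ d (suc a) (suc b) (suc y) w ⟨
  Chain d (suc a) (suc b) (suc y ∷ w)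
    ∎
  where
  open ≡-Reasoning
  y∈[a,b] : Bool
  y∈[a,b] = (a ≤ᵇ y) ∧ (y ≤ᵇ b)

shift-Trees : ∀ h → shift (Trees h) ≗ Trees (suc h)
shift-Trees h []          = refl
shift-Trees h (zero ∷ w)  = refl
shift-Trees h (suc y ∷ w) = begin
  shift (Trees h) (suc y ∷ w)
    ≡⟨ shift-suc-∷ (Trees h) y w ⟩
  shift (∂ y (Trees h)) w
    ≡⟨ shift-cong (Trees-∷ h y) w ⟩
  shift (λ v → ind (y ≡ᵇ h) * Forests (suc h) v) w
    ≡⟨ shift-* (ind (y ≡ᵇ h)) (Forests (suc h)) w ⟩
  ind (y ≡ᵇ h) * shift (Forests (suc h)) w
    ≡⟨ cong (ind (y ≡ᵇ h) *_) (shift-Chain 1 (suc h) (suc h) w) ⟩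
  ind (y ≡ᵇ h) * Forests (2 + h) w
    ≡⟨ Trees-∷ (suc h) (suc y) w ⟨
  Trees (suc h) (suc y ∷ w)
    ∎
  where open ≡-Reasoning

shiftN-Trees : ∀ n → shiftN n (Trees 0) ≗ Trees n
shiftN-Trees zero    w = refl
shiftN-Trees (suc n) w = trans (shift-cong (shiftN-Trees n) w) (shift-Trees n w)

shift-C1 : shift C1 ≗ C≥ 2
shift-C1 []          = refl
shift-C1 (zero ∷ w)  = refl
shift-C1 (suc y ∷ w) = begin
  shift C1 (suc y ∷ w)              ≡⟨ shift-suc-∷ C1 y w ⟩
  shift (∂ y C1) w                  ≡⟨ shift-cong (λ v → sym (Chain-as-C≥ 1 y (y ∷ v) (just ≤-refl))) w ⟩
  shift (∂ y (Chain 1 1 y)) w       ≡⟨ shift-suc-∷ (Chain 1 1 y) y w ⟨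
  shift (Chain 1 1 y) (suc y ∷ w)   ≡⟨ shift-Chain 1 1 y (suc y ∷ w) ⟩
  Chain 1 2 (suc y) (suc y ∷ w)     ≡⟨ Chain-as-C≥ 2 (suc y) (suc y ∷ w) (just ≤-refl) ⟩
  C≥ 2 (suc y ∷ w)                  ∎
  where open ≡-Reasoning

-- Parsing the words of trees

chainᵇ-∷⁻ : ∀ {d a b y} w → T (chainᵇ d a b (y ∷ w)) → a ≤ y × y ≤ b × T (chainᵇ d a (d + y) w)
chainᵇ-∷⁻ {d} {a} {b} {y} w t =
  let (y∈[a,b] , t') = Equivalence.to T-∧ t
      (a≤ᵇy , y≤ᵇb)  = Equivalence.to T-∧ y∈[a,b]
  in ≤ᵇ⇒≤ a y a≤ᵇy , ≤ᵇ⇒≤ y b y≤ᵇb , t'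

chainᵇ-∷⁺ : ∀ {d a b y} w → a ≤ y → y ≤ b → T (chainᵇ d a (d + y) w) → T (chainᵇ d a b (y ∷ w))
chainᵇ-∷⁺ w a≤y y≤b t = Equivalence.from T-∧ (Equivalence.from T-∧ (≤⇒≤ᵇ a≤y , ≤⇒≤ᵇ y≤b) , t)

chainᵇ-rebound : ∀ {d a b b'} w → All (_≤ b') (head w) → T (chainᵇ d a b w) → T (chainᵇ d a b' w)
chainᵇ-rebound []      _          t = t
chainᵇ-rebound (y ∷ w) (just y≤b') t = let (a≤y , _ , t') = chainᵇ-∷⁻ w t in chainᵇ-∷⁺ w a≤y y≤b' t'

chainᵇ-mono : ∀ {d a b b'} w → b ≤ b' → T (chainᵇ d a b w) → T (chainᵇ d a b' w)
chainᵇ-mono []      _    t = t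
chainᵇ-mono (y ∷ w) b≤b' t =
  let (_ , y≤b , _) = chainᵇ-∷⁻ w t in chainᵇ-rebound (y ∷ w) (just (≤-trans y≤b b≤b')) t

forest-++-chainᵇ : ∀ {a h} ts v → a ≤ h → T (chainᵇ 1 a h v) → T (chainᵇ 1 a h (wordF h ts ++ v))
forest-++-chainᵇ []              v a≤h t = t
forest-++-chainᵇ {a} {h} (node cs ∷ ts) v a≤h t =
  chainᵇ-∷⁺ ((wordF (suc h) cs ++ wordF h ts) ++ v) a≤h ≤-refl
    (subst (T ∘ chainᵇ 1 a (suc h)) (sym (++-assoc (wordF (suc h) cs) (wordF h ts) v))
      (forest-++-chainᵇ cs (wordF h ts ++ v) (m≤n⇒m≤1+n a≤h)
        (chainᵇ-mono (wordF h ts ++ v) (n≤1+n h) (forest-++-chainᵇ ts v a≤h t))))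

treeᵇ-wordT : ∀ h t → T (treeᵇ h (wordT h t))
treeᵇ-wordT h (node cs) = Equivalence.from T-∧ (≡⇒≡ᵇ h h refl ,
  subst (T ∘ chainᵇ 1 (suc h) (suc h)) (++-identityʳ (wordF (suc h) cs)) (forest-++-chainᵇ cs [] ≤-refl tt))

-- A forest at height k ends exactly where a letter below k appears.
forest-++-injective : ∀ k ts ts' v v' → All (_< k) (head v) → All (_< k) (head v') →
  wordF k ts ++ v ≡ wordF k ts' ++ v' → ts ≡ ts' × v ≡ v'
forest-++-injective k [] [] v v' _ _ eq = refl , eq
forest-++-injective k [] (node _ ∷ _) (x ∷ v) v' (just x<k) _ eq = ⊥-elim (<-irrefl (proj₁ (∷-injective eq)) x<k)
forest-++-injective k (node _ ∷ _) [] v (x ∷ v') _ (just x<k) eq = ⊥-elim (<-irrefl (sym (proj₁ (∷-injective eq))) x<k)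
forest-++-injective k (node cs ∷ ts) (node cs' ∷ ts') v v' v<k v'<k eq
  with forest-++-injective (suc k) cs cs' (wordF k ts ++ v) (wordF k ts' ++ v')
         (forest-++-below ts v v<k) (forest-++-below ts' v' v'<k) children
  where
  forest-++-below : ∀ ts v → All (_< k) (head v) → All (_< suc k) (head (wordF k ts ++ v))
  forest-++-below []             []      _          = nothing
  forest-++-below []             (x ∷ _) (just x<k) = just (m<n⇒m<1+n x<k)
  forest-++-below (node _ ∷ _)   _       _          = just (n<1+n k)
  children : wordF (suc k) cs ++ (wordF k ts ++ v) ≡ wordF (suc k) cs' ++ (wordF k ts' ++ v')
  children = trans (sym (++-assoc (wordF (suc k) cs) (wordF k ts) v))
               (trans (proj₂ (∷-injective eq)) (++-assoc (wordF (suc k) cs') (wordF k ts') v'))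
... | refl , rest with forest-++-injective k ts ts' v v' v<k v'<k rest
...   | refl , refl = refl , refl

wordT-injective : ∀ h t t' → wordT h t ≡ wordT h t' → t ≡ t'
wordT-injective h t t' eq =
  proj₁ (∷-injective (proj₁ (forest-++-injective h (t ∷ []) (t' ∷ []) [] [] nothing nothing
                                                 (cong (λ z → (z ++ []) ++ []) eq))))

record ForestPrefix (a k : ℕ) (w : Word) : Set where
  constructor prefix
  field
    forest     : List Tree
    rest       : Word
    split      : w ≡ wordF k forest ++ rest
    rest-below : All (_< k) (head rest)
    rest-chain : T (chainᵇ 1 a k rest)

parseForest : ∀ n {a k} w → length w ≤ n → T (chainᵇ 1 a k w) → ForestPrefix a k w
parseForest n       []      _ _ = prefix [] [] refl nothing tt
parseForest (suc n) {a} {k} (x ∷ w) (s≤s |w|≤n) t with <-cmp x k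
... | tri< x<k _ _ = prefix [] (x ∷ w) refl (just x<k) t
... | tri> _ _ k<x = ⊥-elim (<⇒≱ k<x (proj₁ (proj₂ (chainᵇ-∷⁻ w t))))
... | tri≈ _ refl _ =
  let prefix cs v₁ w≡cs++v₁ v₁<1+k t₁ = parseForest n w |w|≤n (proj₂ (proj₂ (chainᵇ-∷⁻ w t)))
      |v₁|≤|w| = ≤-trans (m≤n+m (length v₁) (length (wordF (suc k) cs)))
                         (≤-reflexive (sym (trans (cong length w≡cs++v₁) (length-++ (wordF (suc k) cs)))))
      prefix ts v v₁≡ts++v v<k t₂ = parseForest n v₁ (≤-trans |v₁|≤|w| |w|≤n)
                                     (chainᵇ-rebound v₁ (All-map ≤-pred v₁<1+k) t₁)
  in prefix (node cs ∷ ts) v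
     (cong (k ∷_) (trans w≡cs++v₁ (trans (cong (wordF (suc k) cs ++_) v₁≡ts++v)
                                        (sym (++-assoc (wordF (suc k) cs) (wordF k ts) v)))))
     v<k t₂

treeᵇ⇒wordT : ∀ h w → T (treeᵇ h w) → Σ Tree (λ t → wordT h t ≡ w)
treeᵇ⇒wordT h (y ∷ w) t
  with Equivalence.to T-∧ t
... | y≡ᵇh , tw with ≡ᵇ⇒≡ y h y≡ᵇh | parseForest (length w) w ≤-refl tw
...   | refl | prefix cs []      w≡cs++[] _          _  = node cs , cong (y ∷_) (sym (trans w≡cs++[] (++-identityʳ _)))
...   | refl | prefix cs (z ∷ v) _        (just z<1+h) tv = ⊥-elim (<⇒≱ z<1+h (proj₁ (chainᵇ-∷⁻ v tv)))

tree-with-word-unique : ∀ h w (s s' : Σ Tree (λ t → wordT h t ≡ w)) → s ≡ s'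
tree-with-word-unique h w (t , wt≡w) (t' , wt'≡w) with wordT-injective h t t' (trans wt≡w (sym wt'≡w))
... | refl = cong (t ,_) (Decidable⇒UIP.≡-irrelevant (≡-dec _≟_) wt≡w wt'≡w)

contractible↔Fin1 : ∀ {X : Set} (x : X) → (∀ y → y ≡ x) → X ↔ Fin 1
contractible↔Fin1 x contract = mk↔ₛ′ (λ _ → Fin.zero) (λ _ → x) (λ { Fin.zero → refl ; (Fin.suc ()) }) (sym ∘ contract)

empty↔Fin0 : ∀ {X : Set} → ¬ X → X ↔ Fin 0
empty↔Fin0 ¬x = mk↔ₛ′ (⊥-elim ∘ ¬x) (λ ()) (λ ()) (⊥-elim ∘ ¬x)

tree-language : ∀ A → IsTreeLanguage A → A ≗ Trees 0
tree-language A A-trees w with treeᵇ 0 w in eq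
... | true  = let s = treeᵇ⇒wordT 0 w (subst T (sym eq) tt)
              in ↔⇒≡ (↔-trans (A-trees w) (contractible↔Fin1 s (λ s' → tree-with-word-unique 0 w s' s)))
... | false = ↔⇒≡ (↔-trans (A-trees w) (empty↔Fin0 λ (t , wt≡w) →
                subst T (trans (cong (treeᵇ 0) wt≡w) eq) (treeᵇ-wordT 0 t)))

shiftN-tree-language : ∀ A → IsTreeLanguage A → ∀ n → shiftN n A ≗ Trees n
shiftN-tree-language A A-trees n w = trans (shiftN-cong n (tree-language A A-trees) w) (shiftN-Trees n w)

-- Shift plethysm and the ordered products

Chain-by-first-tree : ∀ {a b} M w → b ≤ M →
  one w + ∑[ x < suc M ] (ind ((a ≤ᵇ x) ∧ (x ≤ᵇ b)) * mul (Trees x) (Chain 1 a x) w) ≡ Chain 1 a b w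
Chain-by-first-tree {a} {b} M [] _ =
  cong suc (trans (∑-cong (suc M) (λ x _ → *-zeroʳ (ind ((a ≤ᵇ x) ∧ (x ≤ᵇ b))))) (∑-zero (suc M)))
Chain-by-first-tree {a} {b} M (y ∷ w) b≤M = begin
  ∑[ x < suc M ] (ind (x∈[a,b] x) * mul (Trees x) (Chain 1 a x) (y ∷ w))
    ≡⟨ ∑-cong (suc M) (λ x _ → term x) ⟩
  ∑[ x < suc M ] (ind (y ≡ᵇ x) * (ind (x∈[a,b] x) * Chain 1 a (suc x) w))
    ≡⟨ ∑-ind-≡ᵇ y (λ x → ind (x∈[a,b] x) * Chain 1 a (suc x) w) (suc M) ⟩
  ind (y <ᵇ suc M) * (ind (x∈[a,b] y) * Chain 1 a (suc y) w)
    ≡⟨ drop-y<1+M ⟩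
  ind (x∈[a,b] y) * Chain 1 a (suc y) w
    ≡⟨ Chain-∷ 1 a b y w ⟨
  Chain 1 a b (y ∷ w)
    ∎
  where
  open ≡-Reasoning
  x∈[a,b] : ℕ → Bool
  x∈[a,b] x = (a ≤ᵇ x) ∧ (x ≤ᵇ b)

  term : ∀ x → ind (x∈[a,b] x) * mul (Trees x) (Chain 1 a x) (y ∷ w)
             ≡ ind (y ≡ᵇ x) * (ind (x∈[a,b] x) * Chain 1 a (suc x) w)
  term x with a ≤? x
  ... | yes a≤x = trans (cong (ind (x∈[a,b] x) *_) (Trees-mul-Chain y w (m≤n⇒m≤1+n a≤x)))
                        (m*[n*o]≡n*[m*o] (ind (x∈[a,b] x)) (ind (y ≡ᵇ x)) _)
  ... | no a≰x  = trans (cong (_* mul (Trees x) (Chain 1 a x) (y ∷ w)) x∉[a,b])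
                        (sym (trans (cong (λ i → ind (y ≡ᵇ x) * (i * Chain 1 a (suc x) w)) x∉[a,b])
                                    (*-zeroʳ (ind (y ≡ᵇ x)))))
    where
    x∉[a,b] : ind (x∈[a,b] x) ≡ 0
    x∉[a,b] = ind-¬T (a≰x ∘ ≤ᵇ⇒≤ a x ∘ proj₁ ∘ Equivalence.to T-∧)

  drop-y<1+M : ind (y <ᵇ suc M) * (ind (x∈[a,b] y) * Chain 1 a (suc y) w) ≡ ind (x∈[a,b] y) * Chain 1 a (suc y) w
  drop-y<1+M with y ≤? b
  ... | yes y≤b = trans (cong (_* _) (ind-T (<⇒<ᵇ (s≤s (≤-trans y≤b b≤M))))) (*-identityˡ _)
  ... | no y≰b  = trans (cong (λ i → ind (y <ᵇ suc M) * (i * Chain 1 a (suc y) w)) y∉[a,b])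
                        (trans (*-zeroʳ (ind (y <ᵇ suc M))) (sym (cong (_* Chain 1 a (suc y) w) y∉[a,b])))
    where
    y∉[a,b] : ind (x∈[a,b] y) ≡ 0
    y∉[a,b] = ind-¬T (y≰b ∘ ≤ᵇ⇒≤ y b ∘ proj₂ ∘ Equivalence.to T-∧)

shiftProd : Series → Word → Series
shiftProd R κ = prodList (map (λ k → shiftN k R) κ)

plethLen : Series → ℕ → ℕ → (Word → ℕ) → Series
plethLen R M l c w = sum (map (λ κ → c κ * shiftProd R κ w) (listsOfLen M l))

plethPartial-by-length : ∀ T R M w → plethPartial T R M w ≡ ∑[ l < suc M ] plethLen R M l T w
plethPartial-by-length T R M w =
  trans (sum-concatMap (λ κ → T κ * shiftProd R κ w) (listsOfLen M) (upTo (suc M))) (sum-upTo _ (suc M))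

plethLen-scale : ∀ R M l {c c'} k w → (∀ κ → c κ ≡ k * c' κ) → plethLen R M l c w ≡ k * plethLen R M l c' w
plethLen-scale R M l {c} {c'} k w c≡k*c' = go (listsOfLen M l)
  where
  go : ∀ κs → sum (map (λ κ → c κ * shiftProd R κ w) κs) ≡ k * sum (map (λ κ → c' κ * shiftProd R κ w) κs)
  go []       = sym (*-zeroʳ k)
  go (κ ∷ κs) = trans (cong₂ _+_ (trans (cong (_* shiftProd R κ w) (c≡k*c' κ)) (*-assoc k (c' κ) _)) (go κs))
                      (sym (*-distribˡ-+ k _ _))

plethLen-suc : ∀ R M l c w → plethLen R M (suc l) c w ≡ ∑[ x < suc M ] mul (shiftN x R) (plethLen R M l (c ∘ (x ∷_))) w
plethLen-suc R M l c w = begin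
  sum (map φ (concatMap (λ x → map (x ∷_) (listsOfLen M l)) (upTo (suc M))))
    ≡⟨ sum-concatMap φ (λ x → map (x ∷_) (listsOfLen M l)) (upTo (suc M)) ⟩
  sum (map (λ x → sum (map φ (map (x ∷_) (listsOfLen M l)))) (upTo (suc M)))
    ≡⟨ sum-upTo _ (suc M) ⟩
  ∑[ x < suc M ] sum (map φ (map (x ∷_) (listsOfLen M l)))
    ≡⟨ ∑-cong (suc M) (λ x _ → first-factor x) ⟩
  ∑[ x < suc M ] mul (shiftN x R) (plethLen R M l (c ∘ (x ∷_))) w
    ∎
  where
  open ≡-Reasoning
  φ : Word → ℕ
  φ κ = c κ * shiftProd R κ w
  first-factor : ∀ x → sum (map φ (map (x ∷_) (listsOfLen M l))) ≡ mul (shiftN x R) (plethLen R M l (c ∘ (x ∷_))) w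
  first-factor x = begin
    sum (map φ (map (x ∷_) (listsOfLen M l)))
      ≡⟨ cong sum (sym (map-∘ (listsOfLen M l))) ⟩
    sum (map (λ κ → c (x ∷ κ) * mul (shiftN x R) (shiftProd R κ) w) (listsOfLen M l))
      ≡⟨ cong sum (map-cong (λ κ → sym (mul-*ʳ (c (x ∷ κ)) (shiftN x R) (shiftProd R κ) w)) (listsOfLen M l)) ⟩
    sum (map (λ κ → mul (shiftN x R) (λ v → c (x ∷ κ) * shiftProd R κ v) w) (listsOfLen M l))
      ≡⟨ mul-sumʳ (shiftN x R) (λ κ v → c (x ∷ κ) * shiftProd R κ v) (listsOfLen M l) w ⟨
    mul (shiftN x R) (plethLen R M l (c ∘ (x ∷_))) w
      ∎

∑plethLen-by-first-letter : ∀ R M L c w →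
  ∑[ l < suc L ] plethLen R M l c w
    ≡ c [] * one w + ∑[ x < suc M ] mul (shiftN x R) (λ v → ∑[ l < L ] plethLen R M l (c ∘ (x ∷_)) v) w
∑plethLen-by-first-letter R M L c w = cong₂ _+_ (+-identityʳ (c [] * one w)) (begin
  ∑[ l < L ] plethLen R M (suc l) c w
    ≡⟨ ∑-cong L (λ l _ → plethLen-suc R M l c w) ⟩
  ∑[ l < L ] ∑[ x < suc M ] mul (shiftN x R) (plethLen R M l (c ∘ (x ∷_))) w
    ≡⟨ ∑-comm (λ l x → mul (shiftN x R) (plethLen R M l (c ∘ (x ∷_))) w) L (suc M) ⟩
  ∑[ x < suc M ] ∑[ l < L ] mul (shiftN x R) (plethLen R M l (c ∘ (x ∷_))) w
    ≡⟨ ∑-cong (suc M) (λ x _ → sym (mul-∑ʳ (shiftN x R) (λ l → plethLen R M l (c ∘ (x ∷_))) L w)) ⟩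
  ∑[ x < suc M ] mul (shiftN x R) (λ v → ∑[ l < L ] plethLen R M l (c ∘ (x ∷_)) v) w
    ∎)
  where open ≡-Reasoning

ordProd-cong : ∀ {F F'} → (∀ n → F n ≗ F' n) → ∀ a k → ordProd F a k ≗ ordProd F' a k
ordProd-cong F≗F' a zero    = F≗F' a
ordProd-cong F≗F' a (suc k) = mul-cong (F≗F' (a + suc k)) (ordProd-cong F≗F' a k)

_⟶-resp-≗_ : ∀ {s L L'} → s ⟶ L → L ≗ L' → s ⟶ L'
(s⟶L ⟶-resp-≗ L≗L') w = let (N , stable) = s⟶L w in N , λ m N≤m → trans (stable m N≤m) (L≗L' w)

head≤sum : ∀ {M} w → sum w ≤ M → All (_≤ M) (head w)
head≤sum []      _ = nothing
head≤sum (y ∷ w) y+sum≤M = just (m+n≤o⇒m≤o y y+sum≤M)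

module _ (R : Series) (R-trees : ∀ n → shiftN n R ≗ Trees n) where

  ∑plethLen-Chain-step : ∀ {a b M} L c w → b ≤ M → (∀ κ → All (_≤ M) (head κ) → c κ ≡ Chain 0 a b κ) →
    (∀ x → x ≤ M → ∀ v → length v < length w → ∑[ l < L ] plethLen R M l (Chain 0 a x) v ≡ Chain 1 a x v) →
    ∑[ l < suc L ] plethLen R M l c w ≡ Chain 1 a b w
  ∑plethLen-Chain-step {a} {b} {M} L c w b≤M c≡ IH = begin
    ∑[ l < suc L ] plethLen R M l c w
      ≡⟨ ∑plethLen-by-first-letter R M L c w ⟩
    c [] * one w + ∑[ x < suc M ] mul (shiftN x R) (λ v → ∑[ l < L ] plethLen R M l (c ∘ (x ∷_)) v) w
      ≡⟨ cong₂ _+_ (trans (cong (_* one w) (c≡ [] nothing)) (*-identityˡ (one w)))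
                   (∑-cong (suc M) (λ x x<1+M → first-tree x (≤-pred x<1+M))) ⟩
    one w + ∑[ x < suc M ] (ind (x∈[a,b] x) * mul (Trees x) (Chain 1 a x) w)
      ≡⟨ Chain-by-first-tree M w b≤M ⟩
    Chain 1 a b w
      ∎
    where
    open ≡-Reasoning
    x∈[a,b] : ℕ → Bool
    x∈[a,b] x = (a ≤ᵇ x) ∧ (x ≤ᵇ b)
    first-tree : ∀ x → x ≤ M → mul (shiftN x R) (λ v → ∑[ l < L ] plethLen R M l (c ∘ (x ∷_)) v) w
                             ≡ ind (x∈[a,b] x) * mul (Trees x) (Chain 1 a x) w
    first-tree x x≤M = begin
      mul (shiftN x R) (λ v → ∑[ l < L ] plethLen R M l (c ∘ (x ∷_)) v) w
        ≡⟨ mul-cong {shiftN x R} (λ _ → refl) (λ v → trans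
             (∑-cong L (λ l _ → plethLen-scale R M l (ind (x∈[a,b] x)) v
                                  (λ κ → trans (c≡ (x ∷ κ) (just x≤M)) (Chain-∷ 0 a b x κ))))
             (∑-* (ind (x∈[a,b] x)) (λ l → plethLen R M l (Chain 0 a x) v) L)) w ⟩
      mul (shiftN x R) (λ v → ind (x∈[a,b] x) * ∑[ l < L ] plethLen R M l (Chain 0 a x) v) w
        ≡⟨ mul-*ʳ (ind (x∈[a,b] x)) (shiftN x R) (λ v → ∑[ l < L ] plethLen R M l (Chain 0 a x) v) w ⟩
      ind (x∈[a,b] x) * mul (shiftN x R) (λ v → ∑[ l < L ] plethLen R M l (Chain 0 a x) v) w
        ≡⟨ cong (ind (x∈[a,b] x) *_) (mul-congʳ-< {shiftN x R} w (R-trees x []) (IH x x≤M)) ⟩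
      ind (x∈[a,b] x) * mul (shiftN x R) (Chain 1 a x) w
        ≡⟨ cong (ind (x∈[a,b] x) *_) (mul-cong (R-trees x) (λ _ → refl) w) ⟩
      ind (x∈[a,b] x) * mul (Trees x) (Chain 1 a x) w
        ∎

  ∑plethLen-Chain : ∀ {a b M} L c w → b ≤ M → length w ≤ L →
    (∀ κ → All (_≤ M) (head κ) → c κ ≡ Chain 0 a b κ) →
    ∑[ l < suc L ] plethLen R M l c w ≡ Chain 1 a b w
  ∑plethLen-Chain zero    c w b≤M |w|≤0 c≡ = ∑plethLen-Chain-step zero c w b≤M c≡ λ _ _ v |v|<|w| →
    ⊥-elim (n≮0 (<-≤-trans |v|<|w| |w|≤0))
  ∑plethLen-Chain {a} (suc L) c w b≤M |w|≤1+L c≡ = ∑plethLen-Chain-step (suc L) c w b≤M c≡ λ x x≤M v |v|<|w| →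
    ∑plethLen-Chain L (Chain 0 a x) v x≤M (≤-pred (<-≤-trans |v|<|w| |w|≤1+L)) λ _ _ → refl

  plethPartial-converges : ∀ a → (λ M → plethPartial (partSeries a) R M) ⟶ C≥ a
  plethPartial-converges a w = length w + sum w , λ M N≤M → begin
    plethPartial (partSeries a) R M w
      ≡⟨ plethPartial-by-length (partSeries a) R M w ⟩
    ∑[ l < suc M ] plethLen R M l (partSeries a) w
      ≡⟨ ∑plethLen-Chain M (partSeries a) w ≤-refl (m+n≤o⇒m≤o (length w) N≤M)
         (λ κ κ≤M → sym (Chain-as-partSeries a M κ κ≤M)) ⟩
    Chain 1 a M w
      ≡⟨ Chain-as-C≥ a M w (head≤sum w (m+n≤o⇒n≤o (length w) N≤M)) ⟩
    C≥ a w
      ∎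
    where open ≡-Reasoning

  ordProd-converges : ∀ a → (λ k → ordProd (λ n → geom (shiftN n R)) a k) ⟶ C≥ a
  ordProd-converges a w = sum w , λ k sum≤k → begin
    ordProd (λ n → geom (shiftN n R)) a k w
      ≡⟨ ordProd-cong (λ n v → trans (geom-cong (R-trees n) v) (geom-Trees n v)) a k w ⟩
    ordProd Forests a k w
      ≡⟨ ordProd-Forests a k w ⟩
    Chain 1 a (a + k) w
      ≡⟨ Chain-as-C≥ a (a + k) w (head≤sum w (≤-trans sum≤k (m≤n+m k a))) ⟩
    C≥ a w
      ∎
    where open ≡-Reasoning

mainTheorem12 : (A : Series) → IsTreeLanguage A →
    ((λ M → plethPartial (partSeries 1) A M) ⟶ C1)
    × ((λ k → ordProd (λ n → geom (shiftN n A)) 1 k) ⟶ C1)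
    × ((λ M → plethPartial (partSeries 2) A M) ⟶ shift C1)
    × ((λ k → ordProd (λ n → geom (shiftN n A)) 2 k) ⟶ shift C1)
mainTheorem12 A A-trees =
    plethPartial-converges A A-trees′ 1
  , ordProd-converges A A-trees′ 1
  , plethPartial-converges A A-trees′ 2 ⟶-resp-≗ (sym ∘ shift-C1)
  , ordProd-converges A A-trees′ 2 ⟶-resp-≗ (sym ∘ shift-C1)
  where
  A-trees′ : ∀ n → shiftN n A ≗ Trees n
  A-trees′ = shiftN-tree-language A A-trees
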